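{- Let $G$ be a graph with no induced subgraph that is a $(4,\xi)$-reducible subgraph of $G$, where $\xi=2^{ -48}$. Then no stressed vertex of $G$ has two neighbors in a conductive triangle.
   Context: All graphs are finite and simple; degrees are in $G$. For $f:V(H)\to\mathbb Z$, an $f$-assignment on $H$ assigns each $v$ a set $L(v)\subseteq\mathbb N$ with $|L(v)|=\max\{0,f(v)\}$; an $L$-coloring is a proper coloring $\phi$ with $\phi(v)\in L(v)$. For an induced subgraph $H$ of $G$, let $\ell_H(v)=4-\deg_G(v)+\deg_H(v)$. $H$ is a $(4,\xi)$-reducible subgraph of $G$ if for every $\ell_H$-assignment $L$ on $H$ there is a probability distribution on $L$-colorings $\phi$ of $H$ with (FIX) $\Pr(\phi(v)=c)\ge\xi$ for all $v\in V(H)$, $c\in L(v)$; (FORB) for all $U\subseteq V(H)$ with $|U|\le2$ and $c\in\bigcup_{u\in U}L(u)$, $\Pr(\phi(u)\ne c\ \forall u\in U)\ge\xi$. A vertex of degree $4$ is stressed if it has exactly two neighbors of degree $3$, and conductive if it has exactly one neighbor of degree $3$. A conductive triangle is a $K_3$ subgraph all of whose vertices are conductive. -}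

module Defs where

open import Data.Nat as ℕ using (ℕ; _+_; _∸_; _^_)
open import Data.Bool using (Bool; true; false; T; _∧_; if_then_else_; not)
open import Data.Fin using (Fin)
open import Data.List using (List; []; _∷_; length; map; allFin)
open import Data.Nat.ListAction using (sum)
open import Data.List.Membership.Propositional using (_∈_)
open import Data.List.Relation.Unary.Unique.Propositional using (Unique)
open import Data.List.Relation.Unary.All using (All)
open import Data.Product using (Σ; ∃; _×_; _,_; proj₁; proj₂)
open import Data.Sum using (_⊎_)
open import Data.Empty using (⊥)
open import Relation.Nullary using (¬_; does)
open import Relation.Binary.PropositionalEquality using (_≡_; _≢_)
open import Data.Rational as ℚ using (ℚ; 0ℚ; 1ℚ)
open import Data.Integer using (+_)

record Graph (n : ℕ) : Set where
  field
    adj    : Fin n → Fin n → Bool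
    sym    : ∀ u v → adj u v ≡ adj v u
    irrefl : ∀ v → adj v v ≡ false
open Graph public

-- Vertex subsets (determine induced subgraphs).
VSet : ℕ → Set
VSet n = Fin n → Bool

degIn : ∀ {n} → Graph n → VSet n → Fin n → ℕ
degIn {n} G S v = sum (map (λ u → if adj G v u ∧ S u then 1 else 0) (allFin n))

deg : ∀ {n} → Graph n → Fin n → ℕ
deg G v = degIn G (λ _ → true) v

-- max{0, ℓ_H(v)} = max{0, 4 - deg_G(v) + deg_H(v)}, H = G[S]
ℓ : ∀ {n} → Graph n → VSet n → Fin n → ℕ
ℓ G S v = (4 + degIn G S v) ∸ deg G v

-- an ℓ_H-assignment on H = G[S]: each v ∈ S gets a set of naturals of size max{0,ℓ_H(v)}
-- (values at vertices outside S are irrelevant)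
IsAssignment : ∀ {n} → Graph n → VSet n → (Fin n → List ℕ) → Set
IsAssignment {n} G S L = ∀ (v : Fin n) → T (S v) → Unique (L v) × length (L v) ≡ ℓ G S v

IsLColoring : ∀ {n} → Graph n → VSet n → (Fin n → List ℕ) → (Fin n → ℕ) → Set
IsLColoring {n} G S L φ =
  (∀ (v : Fin n) → T (S v) → φ v ∈ L v) ×
  (∀ (u v : Fin n) → T (S u) → T (S v) → T (adj G u v) → φ u ≢ φ v)

Distribution : ℕ → Set
Distribution n = List ((Fin n → ℕ) × ℚ)

Pr : ∀ {n} → Distribution n → ((Fin n → ℕ) → Bool) → ℚ
Pr [] E = 0ℚ
Pr ((φ , p) ∷ D) E = (if E φ then p else 0ℚ) ℚ.+ Pr D E

totalMass : ∀ {n} → Distribution n → ℚ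
totalMass [] = 0ℚ
totalMass ((φ , p) ∷ D) = p ℚ.+ totalMass D

IsDistributionOnLColorings : ∀ {n} → Graph n → VSet n → (Fin n → List ℕ) → Distribution n → Set
IsDistributionOnLColorings G S L D =
  All (λ e → IsLColoring G S L (proj₁ e) × 0ℚ ℚ.≤ proj₂ e) D × totalMass D ≡ 1ℚ

_=ᵇ_ : ℕ → ℕ → Bool
a =ᵇ b = does (a ℕ.≟ b)

-- G[S] is a (4,ξ)-reducible subgraph of G.
-- FORB for |U| ≤ 2: U = ∅ is vacuous; U = {u} and U = {u,w} are covered by u, w ∈ S (u = w allowed).
Reducible : ∀ {n} → Graph n → VSet n → ℚ → Set
Reducible {n} G S ξ =
  ∀ (L : Fin n → List ℕ) → IsAssignment G S L →
  Σ (Distribution n) λ D → IsDistributionOnLColorings G S L D ×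
    (∀ (v : Fin n) (c : ℕ) → T (S v) → c ∈ L v → ξ ℚ.≤ Pr D (λ φ → φ v =ᵇ c)) ×
    (∀ (u w : Fin n) (c : ℕ) → T (S u) → T (S w) → (c ∈ L u ⊎ c ∈ L w) →
       ξ ℚ.≤ Pr D (λ φ → not (φ u =ᵇ c) ∧ not (φ w =ᵇ c)))

NonEmpty : ∀ {n} → VSet n → Set
NonEmpty {n} S = ∃ λ (v : Fin n) → T (S v)

deg3Nbrs : ∀ {n} → Graph n → Fin n → ℕ
deg3Nbrs {n} G v = sum (map (λ u → if adj G v u ∧ (deg G u =ᵇ 3) then 1 else 0) (allFin n))

Stressed : ∀ {n} → Graph n → Fin n → Set
Stressed G v = deg G v ≡ 4 × deg3Nbrs G v ≡ 2

Conductive : ∀ {n} → Graph n → Fin n → Set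
Conductive G v = deg G v ≡ 4 × deg3Nbrs G v ≡ 1

ConductiveTriangle : ∀ {n} → Graph n → Fin n → Fin n → Fin n → Set
ConductiveTriangle G a b c =
  T (adj G a b) × T (adj G b c) × T (adj G a c) ×
  Conductive G a × Conductive G b × Conductive G c

ξ₀ : ℚ
ξ₀ = + 1 ℚ./ (2 ^ 48)

-- Let x and y be the degree-3 neighbours of the stressed vertex v. If one of a, b, c is adjacent
-- to x or y, the subgraph induced by v, a, b, c, x, y is reducible; otherwise so is the one
-- induced by these vertices and the degree-3 neighbour z of a. Reducibility of such a
-- configuration is decided by computation, uniformly in its unknown adjacencies: for every
-- assignment of lists of the sizes ℓ, there are proper colourings fixing any vertex to any of its
-- colours (FIX) and avoiding any colour at any two vertices (FORB). These colourings come from a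
-- search whose successes are justified by greedy colouring along a degeneracy order and by a
-- "diamond" rule for two non-adjacent vertices p, q with a common neighbour r. For a configuration
-- of k ≤ 7 vertices, the uniform distribution on k·4 + k·k·8 such colourings gives every FIX and
-- FORB event probability at least 1/420, far above 2⁻⁴⁸.
module Submission where

open import Defs hiding (sym)
open import Data.Rational as ℚ using (ℚ; 0ℚ; 1ℚ; _/_)
import Data.Rational.Properties as ℚ
open import Algebra.Definitions.RawMonoid ℚ.+-0-rawMonoid using () renaming (_×_ to _×ℚ_)
open import Data.Bool using (Bool; true; false; T; T?; _∧_; _∨_; not; if_then_else_)
open import Data.Bool.ListAction using (all; any)
open import Data.Bool.Properties using (T-∧; T-∨; T-not-≡; ∧-comm)
open import Data.Empty using (⊥; ⊥-elim)
open import Data.Fin using (Fin; zero; suc; toℕ)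
open import Data.Fin.Properties using (_≟_; any?)
open import Data.Integer using (+_)
open import Data.List
  using (List; []; _∷_; [_]; length; map; filter; filterᵇ; findᵇ; take; allFin; _++_; concatMap; replicate;
         cartesianProductWith)
open import Data.List.Membership.Propositional using (_∈_; _∉_; find; lose; mapWith∈)
open import Data.List.Membership.Propositional.Properties
  using (∈-∃++; ∈-++⁺ˡ; ∈-++⁺ʳ; ∈-++⁻; ∈-map⁺; ∈-map⁻; ∈-filter⁺; ∈-filter⁻; ∈-allFin; ∈-cartesianProductWith⁺)
import Data.List.Membership.Setoid.Properties as SetoidMembership
open import Data.List.Properties
  using (length-map; length-++; length-++-sucʳ; length-take; length-replicate; length-tabulate)
open import Data.List.Relation.Binary.Subset.Propositional using (_⊆_)
import Data.List.Relation.Binary.Sublist.Propositional as Sublist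
open import Data.List.Relation.Binary.Sublist.Propositional.Properties using (take-⊆)
open import Data.List.Relation.Unary.All as All using (All; []; _∷_)
open import Data.List.Relation.Unary.All.Properties using (all⁺; all⁻; ¬All⇒Any¬; all-filter)
  renaming (map⁺ to All-map⁺)
open import Data.List.Relation.Unary.Any as Any using (Any; here; there)
open import Data.List.Relation.Unary.Any.Properties using (any⁺; any⁻; concat⁺; mapWith∈⁺; ++⁺ˡ; ++⁺ʳ)
  renaming (map⁺ to Any-map⁺)
open import Data.List.Relation.Unary.Unique.Propositional using (Unique; []; _∷_)
open import Data.List.Relation.Unary.Unique.Propositional.Properties using (filter⁺; take⁺; ++⁺; allFin⁺)
  renaming (map⁺ to Unique-map⁺)
open import Data.Maybe using (Maybe; just; nothing)
open import Data.Nat as ℕ using (ℕ; zero; suc; _+_; _*_; _∸_; _≤_; _<_; z≤n; s≤s; _<ᵇ_; _≤ᵇ_)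
open import Data.Nat.ListAction using (sum)
open import Data.Nat.Properties
  using (<-asym; ≤-refl; ≤-reflexive; ≤-trans; <⇒≱; <ᵇ⇒<; ≤⇒≤ᵇ; ≡⇒≡ᵇ; ≡ᵇ⇒≡; +-mono-≤; +-monoʳ-≤; ∸-monoˡ-≤;
         ∸-monoʳ-≤; m≤n⇒m⊓n≡m; m+n∸n≡m; m+[n∸m]≡n; module ≤-Reasoning)
import Data.List.Membership.DecPropositional ℕ._≟_ as ℕ-Membership
open import Data.Product as Product using (∃; ∃₂; _×_; _,_; proj₁; proj₂)
open import Data.Sum as Sum using (_⊎_; inj₁; inj₂; [_,_]′)
open import Data.Unit using (⊤; tt)
open import Data.Vec as Vec using (Vec; []; _∷_)
import Data.Vec.Properties as Vec
open import Data.Vec.Functional using (updateAt)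
open import Data.Vec.Functional.Properties using (updateAt-updates; updateAt-minimal)
open import Data.Vec.Relation.Binary.Pointwise.Inductive as Pointwise using (Pointwise; []; _∷_)
open import Data.Vec.Relation.Unary.All using ([]; _∷_)
open import Data.Vec.Relation.Unary.AllPairs using ([]; _∷_)
open import Data.Vec.Relation.Unary.Unique.Propositional using () renaming (Unique to UniqueVec)
open import Data.Vec.Relation.Unary.Unique.Propositional.Properties using (lookup-injective)
open import Function using (_∘_; const; case_of_; Equivalence)
open import Relation.Nullary using (¬_; yes; no; ¬?)
open import Relation.Nullary.Decidable using (⌊_⌋; toWitness; fromWitness)
open import Relation.Binary.PropositionalEquality
  using (_≡_; _≢_; refl; sym; trans; cong; cong₂; subst; subst₂; setoid; module ≡-Reasoning)

T-not⁺ : ∀ {x} → ¬ T x → T (not x)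
T-not⁺ {false} _  = _
T-not⁺ {true}  ¬t = ¬t _

T-not⁻ : ∀ {x} → T (not x) → ¬ T x
T-not⁻ {false} _ ()

T-∧⁻ : ∀ x {y} → T (x ∧ y) → T x × T y
T-∧⁻ _ = Equivalence.to T-∧

any-witness : ∀ {A : Set} (f : A → Bool) xs → T (any f xs) → ∃ λ x → T (f x)
any-witness f xs = Product.map₂ proj₂ ∘ find ∘ any⁻ f xs

count : ∀ {A : Set} → (A → Bool) → List A → ℕ
count p xs = length (filterᵇ p xs)

sum-indicator≡count : ∀ {A : Set} (p : A → Bool) xs → sum (map (λ x → if p x then 1 else 0) xs) ≡ count p xs
sum-indicator≡count p []       = refl
sum-indicator≡count p (x ∷ xs) with p x
... | true  = cong suc (sum-indicator≡count p xs)
... | false = sum-indicator≡count p xs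

unique-⊆⇒length-≤ : ∀ {A : Set} {xs ys : List A} → Unique xs → xs ⊆ ys → length xs ≤ length ys
unique-⊆⇒length-≤ {xs = []} _ _ = z≤n
unique-⊆⇒length-≤ {xs = x ∷ xs} (x∉xs ∷ u) xs⊆ys with ∈-∃++ (xs⊆ys (here refl))
... | ys₁ , ys₂ , refl = begin
  suc (length xs)           ≤⟨ s≤s (unique-⊆⇒length-≤ u xs⊆ys₁++ys₂) ⟩
  suc (length (ys₁ ++ ys₂)) ≡⟨ sym (length-++-sucʳ ys₁ x ys₂) ⟩
  length (ys₁ ++ x ∷ ys₂)   ∎
  where
    open ≤-Reasoning
    xs⊆ys₁++ys₂ : xs ⊆ ys₁ ++ ys₂
    xs⊆ys₁++ys₂ {z} z∈xs with ∈-++⁻ ys₁ (xs⊆ys (there z∈xs))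
    ... | inj₁ z∈ys₁         = ∈-++⁺ˡ z∈ys₁
    ... | inj₂ (here refl)   = ⊥-elim (All.lookup x∉xs z∈xs refl)
    ... | inj₂ (there z∈ys₂) = ∈-++⁺ʳ ys₁ z∈ys₂

pigeonhole : ∀ {xs ys : List ℕ} → Unique xs → length ys < length xs → ∃ λ c → c ∈ xs × c ∉ ys
pigeonhole {xs} {ys} u shorter with All.all? (ℕ-Membership._∈? ys) xs
... | yes xs⊆ys = ⊥-elim (<⇒≱ shorter (unique-⊆⇒length-≤ u (All.lookup xs⊆ys)))
... | no xs⊈ys  = find (¬All⇒Any¬ (ℕ-Membership._∈? ys) xs xs⊈ys)

_without_ : List ℕ → ℕ → List ℕ
xs without γ = filter (λ c → ¬? (c ℕ.≟ γ)) xs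

∈-without⁻ : ∀ {c γ} xs → c ∈ xs without γ → c ∈ xs × c ≢ γ
∈-without⁻ {γ = γ} xs = ∈-filter⁻ (λ c → ¬? (c ℕ.≟ γ)) {xs = xs}

length-without : ∀ {xs} γ → Unique xs → length xs ≤ suc (length (xs without γ))
length-without {xs} γ u = unique-⊆⇒length-≤ u xs⊆γ∷xs-γ
  where
    xs⊆γ∷xs-γ : xs ⊆ γ ∷ xs without γ
    xs⊆γ∷xs-γ {c} c∈xs with c ℕ.≟ γ
    ... | yes refl = here refl
    ... | no c≢γ   = there (∈-filter⁺ (λ c → ¬? (c ℕ.≟ γ)) c∈xs c≢γ)

without-fits : ∀ {xs m} γ → Unique xs × m ≤ length xs → Unique (xs without γ) × m ∸ 1 ≤ length (xs without γ)
without-fits γ (u , m≤) = filter⁺ (λ c → ¬? (c ℕ.≟ γ)) u , ∸-monoˡ-≤ 1 (≤-trans m≤ (length-without γ u))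

pad : ∀ {A : Set} → ℕ → A → List A → List A
pad m x xs = xs ++ replicate (m ∸ length xs) x

length-pad : ∀ {A : Set} {m} (x : A) xs → length xs ≤ m → length (pad m x xs) ≡ m
length-pad {m = m} x xs xs≤m =
  trans (length-++ xs) (trans (cong (_+_ (length xs)) (length-replicate (m ∸ length xs))) (m+[n∸m]≡n xs≤m))

length-concatMap : ∀ {A B : Set} (f : A → List B) {m} → (∀ x → length (f x) ≡ m) →
                   ∀ xs → length (concatMap f xs) ≡ length xs * m
length-concatMap f f≡m []       = refl
length-concatMap f f≡m (x ∷ xs) = trans (length-++ (f x)) (cong₂ _+_ (f≡m x) (length-concatMap f f≡m xs))

-- List colouring

Adjacency : ℕ → Set
Adjacency k = Fin k → Fin k → Bool

ListAssignment : ℕ → Set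
ListAssignment k = Fin k → List ℕ

_==_ : ∀ {k} → Fin k → Fin k → Bool
i == j = ⌊ i ≟ j ⌋

module _ {k : ℕ} where

  IsSymmetric : Adjacency k → Set
  IsSymmetric A = ∀ i j → A i j ≡ A j i

  IsIrreflexive : Adjacency k → Set
  IsIrreflexive A = ∀ i → ¬ T (A i i)

  IsProperColouring : Adjacency k → ListAssignment k → (Fin k → ℕ) → Set
  IsProperColouring A L ψ = (∀ i → ψ i ∈ L i) × (∀ i j → T (A i j) → ψ i ≢ ψ j)

  Colourable : Adjacency k → ListAssignment k → Set
  Colourable A L = ∃ (IsProperColouring A L)

  IsListAssignment : (Fin k → ℕ) → ListAssignment k → Set
  IsListAssignment b L = ∀ i → Unique (L i) × b i ≤ length (L i)

  Choosable : Adjacency k → (Fin k → ℕ) → Set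
  Choosable A b = ∀ L → IsListAssignment b L → Colourable A L

  choosable-resp-≗ : ∀ {A b b′} → (∀ i → b′ i ≡ b i) → Choosable A b′ → Choosable A b
  choosable-resp-≗ b′≗b choosable L L-fits =
    choosable L λ i → proj₁ (L-fits i) , subst (_≤ length (L i)) (sym (b′≗b i)) (proj₂ (L-fits i))

  exact-choosable : ∀ {A b} → (∀ M → (∀ i → Unique (M i) × length (M i) ≡ b i) → Colourable A M) → Choosable A b
  exact-choosable {A} {b} colour-exact L L-fits =
    proj₁ colouring , (λ i → Sublist.lookup (take-⊆ (b i) (L i)) (proj₁ (proj₂ colouring) i)) ,
    proj₂ (proj₂ colouring)
    where
      colouring = colour-exact (λ i → take (b i) (L i)) λ i →
        take⁺ (b i) (proj₁ (L-fits i)) , trans (length-take (b i) (L i)) (m≤n⇒m⊓n≡m (proj₂ (L-fits i)))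

  all-allFin⁻ : ∀ (f : Fin k → Bool) → T (all f (allFin k)) → ∀ i → T (f i)
  all-allFin⁻ f ok i = All.lookup (all⁺ f (allFin k) ok) (∈-allFin i)

  -- σ lists the vertices in the order of removal, so its head is coloured last.

  degenerate : Adjacency k → (Fin k → ℕ) → List (Fin k) → Bool
  degenerate A b []      = true
  degenerate A b (w ∷ σ) = (count (A w) σ <ᵇ b w) ∧ degenerate A b σ

  IsProperOn : Adjacency k → ListAssignment k → List (Fin k) → (Fin k → ℕ) → Set
  IsProperOn A L σ ψ = (∀ {i} → i ∈ σ → ψ i ∈ L i) × (∀ {i j} → i ∈ σ → j ∈ σ → T (A i j) → ψ i ≢ ψ j)

  module _ {A : Adjacency k} {b : Fin k → ℕ} {L : ListAssignment k}
           (A-sym : IsSymmetric A) (A-irr : IsIrreflexive A) (L-fits : IsListAssignment b L) where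

    free-colour : ∀ {w σ} → count (A w) σ < b w → ∀ ψ → ∃ λ c → c ∈ L w × c ∉ map ψ (filterᵇ (A w) σ)
    free-colour {w} {σ} few ψ = pigeonhole (proj₁ (L-fits w)) (begin-strict
      length (map ψ (filterᵇ (A w) σ)) ≡⟨ length-map ψ (filterᵇ (A w) σ) ⟩
      count (A w) σ                    <⟨ few ⟩
      b w                              ≤⟨ proj₂ (L-fits w) ⟩
      length (L w)                     ∎)
      where open ≤-Reasoning

    colour-last : ∀ {w σ} → count (A w) σ < b w → ∃ (IsProperOn A L σ) → ∃ (IsProperOn A L (w ∷ σ))
    colour-last {w} {σ} few (ψ , inL , proper) with free-colour {w} {σ} few ψ
    ... | c , c∈Lw , c∉used = ψ′ , inL′ , proper′
      where
        ψ′ : Fin k → ℕ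
        ψ′ = updateAt ψ w (const c)

        earlier : ∀ {i} → i ∈ w ∷ σ → i ≢ w → i ∈ σ
        earlier (here refl) i≢w = ⊥-elim (i≢w refl)
        earlier (there i∈σ) _   = i∈σ

        unchanged : ∀ {i} → i ≢ w → ψ′ i ≡ ψ i
        unchanged {i} i≢w = updateAt-minimal i w ψ i≢w

        inL′ : ∀ {i} → i ∈ w ∷ σ → ψ′ i ∈ L i
        inL′ {i} i∈ with i ≟ w
        ... | yes refl = subst (_∈ L w) (sym (updateAt-updates w ψ)) c∈Lw
        ... | no i≢w   = subst (_∈ L i) (sym (unchanged i≢w)) (inL (earlier i∈ i≢w))

        new≢old : ∀ {j} → j ∈ w ∷ σ → j ≢ w → T (A w j) → ψ′ w ≢ ψ′ j
        new≢old {j} j∈ j≢w wj ψ′w≡ψ′j = c∉used (subst (_∈ map ψ (filterᵇ (A w) σ)) ψj≡c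
          (∈-map⁺ ψ (∈-filter⁺ (λ j → T? (A w j)) (earlier j∈ j≢w) wj)))
          where
            ψj≡c : ψ j ≡ c
            ψj≡c = trans (sym (unchanged j≢w)) (trans (sym ψ′w≡ψ′j) (updateAt-updates w ψ))

        proper′ : ∀ {i j} → i ∈ w ∷ σ → j ∈ w ∷ σ → T (A i j) → ψ′ i ≢ ψ′ j
        proper′ {i} {j} i∈ j∈ ij with i ≟ w | j ≟ w
        ... | yes refl | yes refl = ⊥-elim (A-irr w ij)
        ... | yes refl | no j≢w   = new≢old j∈ j≢w ij
        ... | no i≢w   | yes refl = new≢old i∈ i≢w (subst T (A-sym i w) ij) ∘ sym
        ... | no i≢w   | no j≢w   =
          subst₂ _≢_ (sym (unchanged i≢w)) (sym (unchanged j≢w)) (proper (earlier i∈ i≢w) (earlier j∈ j≢w) ij)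

    greedy-colouring : ∀ σ → T (degenerate A b σ) → ∃ (IsProperOn A L σ)
    greedy-colouring []      _  = const 0 , (λ ()) , (λ ())
    greedy-colouring (w ∷ σ) ok =
      let few , rest = T-∧⁻ (count (A w) σ <ᵇ b w) ok
      in colour-last {w} {σ} (<ᵇ⇒< _ _ few) (greedy-colouring σ rest)

  -- An unverified search: greedy? checks the order it proposes.
  removalOrder : ℕ → Adjacency k → (Fin k → ℕ) → List (Fin k) → List (Fin k)
  removalOrder zero       A b R = []
  removalOrder (suc fuel) A b R with findᵇ (λ w → count (A w) R <ᵇ b w) R
  ... | just w  = w ∷ removalOrder fuel A b (filterᵇ (λ j → not (j == w)) R)
  ... | nothing = []

  greedy? : Adjacency k → (Fin k → ℕ) → Bool
  greedy? A b = degenerate A b σ ∧ all (λ i → any (i ==_) σ) (allFin k)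
    where σ = removalOrder k A b (allFin k)

  greedy-choosable : ∀ {A b} → IsSymmetric A → IsIrreflexive A → T (greedy? A b) → Choosable A b
  greedy-choosable {A} {b} A-sym A-irr ok L L-fits =
    ψ , (λ i → inL (covered i)) , (λ i j → proper (covered i) (covered j))
    where
      σ = removalOrder k A b (allFin k)
      ordered = Equivalence.to T-∧ ok
      covered : ∀ i → i ∈ σ
      covered i = Any.map (λ {j} → toWitness {a? = i ≟ j}) (any⁻ (i ==_) σ (all-allFin⁻ _ (proj₂ ordered) i))
      colouring = greedy-colouring A-sym A-irr L-fits σ (proj₁ ordered)
      ψ = proj₁ colouring
      inL = proj₁ (proj₂ colouring)
      proper = proj₂ (proj₂ colouring)

  -- Precolouring an independent set F with one colour γ keeps the vertex set: F is cut off and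
  -- left with the list [γ], and the neighbours of F lose γ, except those in X, whose lists are
  -- known to avoid γ.

  isolate : (Fin k → Bool) → Adjacency k → Adjacency k
  isolate F A i j = A i j ∧ not (F i) ∧ not (F j)

  adjacentTo : Adjacency k → (Fin k → Bool) → Fin k → Bool
  adjacentTo A F w = any (λ f → F f ∧ A f w) (allFin k)

  precolouredBounds : Adjacency k → (F X : Fin k → Bool) → (Fin k → ℕ) → Fin k → ℕ
  precolouredBounds A F X b w =
    if F w then 1 else if adjacentTo A F w ∧ not (X w) then b w ∸ 1 else b w

  precolouredLists : Adjacency k → (F X : Fin k → Bool) → ℕ → ListAssignment k → ListAssignment k
  precolouredLists A F X γ L w =
    if F w then [ γ ] else if adjacentTo A F w ∧ not (X w) then L w without γ else L w

  isolate-sym : ∀ {A} F → IsSymmetric A → IsSymmetric (isolate F A)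
  isolate-sym {A} F A-sym i j rewrite A-sym i j = cong (A j i ∧_) (∧-comm (not (F i)) (not (F j)))

  isolate-irr : ∀ {A} F → IsIrreflexive A → IsIrreflexive (isolate F A)
  isolate-irr F A-irr i = A-irr i ∘ proj₁ ∘ Equivalence.to T-∧

  adjacentTo⁺ : ∀ {A F f w} → T (F f) → T (A f w) → T (adjacentTo A F w)
  adjacentTo⁺ {f = f} Ff Afw = any⁺ _ (lose (∈-allFin f) (Equivalence.from T-∧ (Ff , Afw)))

  precoloured-fits : ∀ {A F X b L} γ → IsListAssignment b L →
                     IsListAssignment (precolouredBounds A F X b) (precolouredLists A F X γ L)
  precoloured-fits {A} {F} {X} γ L-fits w with F w | adjacentTo A F w ∧ not (X w)
  ... | true  | _     = ([] ∷ []) , ≤-refl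
  ... | false | true  = without-fits γ (L-fits w)
  ... | false | false = L-fits w

  module Precoloured (A : Adjacency k) (F X : Fin k → Bool) (γ : ℕ) (L : ListAssignment k) (ψ : Fin k → ℕ)
                     (inL′ : ∀ i → ψ i ∈ precolouredLists A F X γ L i) where

    onF : ∀ f → T (F f) → ψ f ≡ γ
    onF f Ff with F f | inL′ f
    ... | true | here ψf≡γ = ψf≡γ

    inL : (∀ f → T (F f) → γ ∈ L f) → ∀ i → ψ i ∈ L i
    inL γ∈ i with F i in Fi | adjacentTo A F i ∧ not (X i) | inL′ i
    ... | true  | _     | here refl = γ∈ i (subst T (sym Fi) _)
    ... | false | true  | ψi∈       = proj₁ (∈-without⁻ (L i) ψi∈)
    ... | false | false | ψi∈       = ψi∈

    avoids : (∀ x → T (X x) → γ ∉ L x) → ∀ j → ¬ T (F j) → T (adjacentTo A F j) → ψ j ≢ γ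
    avoids γ∉ j ¬Fj adj with F j | adjacentTo A F j | X j in Xj | inL′ j
    ... | true  | _    | _     | _   = ⊥-elim (¬Fj _)
    ... | false | true | true  | ψj∈ = λ ψj≡γ → γ∉ j (subst T (sym Xj) _) (subst (_∈ L j) ψj≡γ ψj∈)
    ... | false | true | false | ψj∈ = proj₂ (∈-without⁻ (L j) ψj∈)

  precolour : ∀ {A F X b L} → IsSymmetric A → (∀ f g → T (F f) → T (F g) → ¬ T (A f g)) →
              Choosable (isolate F A) (precolouredBounds A F X b) → IsListAssignment b L →
              ∀ γ → (∀ f → T (F f) → γ ∈ L f) → (∀ x → T (X x) → γ ∉ L x) →
              ∃ λ ψ → IsProperColouring A L ψ × (∀ f → T (F f) → ψ f ≡ γ)
  precolour {A} {F} {X} {b} {L} A-sym independent choosable L-fits γ γ∈ γ∉ = ψ , (inL γ∈ , proper) , onF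
    where
      colouring = choosable (precolouredLists A F X γ L) (precoloured-fits {A} {F} {X} γ L-fits)
      ψ = proj₁ colouring
      open Precoloured A F X γ L ψ (proj₁ (proj₂ colouring))

      precoloured≢ : ∀ i j → T (F i) → ¬ T (F j) → T (A i j) → ψ i ≢ ψ j
      precoloured≢ i j Fi ¬Fj ij ψi≡ψj =
        avoids γ∉ j ¬Fj (adjacentTo⁺ {A} {F} Fi ij) (trans (sym ψi≡ψj) (onF i Fi))

      proper : ∀ i j → T (A i j) → ψ i ≢ ψ j
      proper i j ij with T? (F i) | T? (F j)
      ... | yes Fi | yes Fj = ⊥-elim (independent i j Fi Fj ij)
      ... | yes Fi | no ¬Fj = precoloured≢ i j Fi ¬Fj ij
      ... | no ¬Fi | yes Fj = precoloured≢ j i Fj ¬Fi (subst T (A-sym i j) ij) ∘ sym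
      ... | no ¬Fi | no ¬Fj = proj₂ (proj₂ colouring) i j
                                (Equivalence.from T-∧ (ij , Equivalence.from T-∧ (T-not⁺ ¬Fi , T-not⁺ ¬Fj)))

  decrementedAt : (Fin k → Bool) → (Fin k → ℕ) → Fin k → ℕ
  decrementedAt U b i = if U i then b i ∸ 1 else b i

  avoid : ∀ {A U b L} → Choosable A (decrementedAt U b) → IsListAssignment b L →
          ∀ γ → ∃ λ ψ → IsProperColouring A L ψ × (∀ u → T (U u) → ψ u ≢ γ)
  avoid {A} {U} {b} {L} choosable L-fits γ = ψ , (inL , proj₂ (proj₂ colouring)) , avoids
    where
      L′ : ListAssignment k
      L′ i = if U i then L i without γ else L i

      L′-fits : IsListAssignment (decrementedAt U b) L′
      L′-fits i with U i
      ... | true  = without-fits γ (L-fits i)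
      ... | false = L-fits i

      colouring = choosable L′ L′-fits
      ψ = proj₁ colouring

      inL : ∀ i → ψ i ∈ L i
      inL i with U i | proj₁ (proj₂ colouring) i
      ... | true  | ψi∈ = proj₁ (∈-without⁻ (L i) ψi∈)
      ... | false | ψi∈ = ψi∈

      avoids : ∀ u → T (U u) → ψ u ≢ γ
      avoids u Uu with U u | proj₁ (proj₂ colouring) u
      ... | true | ψu∈ = proj₂ (∈-without⁻ (L u) ψu∈)

  ∅ : Fin k → Bool
  ∅ _ = false

  ⁅_⁆ : Fin k → Fin k → Bool
  ⁅ p ⁆ w = w == p

  ⁅_⁆∪⁅_⁆ : Fin k → Fin k → Fin k → Bool
  ⁅ p ⁆∪⁅ q ⁆ w = w == p ∨ w == q

  ∈⁅⁆ : ∀ p w → T (⁅ p ⁆ w) → w ≡ p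
  ∈⁅⁆ p w = toWitness {a? = w ≟ p}

  ∈⁅⁆∪⁅⁆ : ∀ p q w → T (⁅ p ⁆∪⁅ q ⁆ w) → w ≡ p ⊎ w ≡ q
  ∈⁅⁆∪⁅⁆ p q w = Sum.map (toWitness {a? = w ≟ p}) (toWitness {a? = w ≟ q}) ∘ Equivalence.to T-∨

  ⁅⁆-∋ : ∀ p → T (⁅ p ⁆ p)
  ⁅⁆-∋ p = fromWitness {a? = p ≟ p} refl

  ⁅⁆∪⁅⁆-∋ˡ : ∀ p q → T (⁅ p ⁆∪⁅ q ⁆ p)
  ⁅⁆∪⁅⁆-∋ˡ p q = Equivalence.from (T-∨ {p == p}) (inj₁ (⁅⁆-∋ p))

  ⁅⁆∪⁅⁆-∋ʳ : ∀ p q → T (⁅ p ⁆∪⁅ q ⁆ q)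
  ⁅⁆∪⁅⁆-∋ʳ p q = Equivalence.from (T-∨ {q == p}) (inj₂ (⁅⁆-∋ q))

  ⁅⁆-elim : ∀ {P : Fin k → Set} p → P p → ∀ w → T (⁅ p ⁆ w) → P w
  ⁅⁆-elim {P} p Pp w w∈ = subst P (sym (∈⁅⁆ p w w∈)) Pp

  singleton-independent : ∀ {A} → IsIrreflexive A → ∀ p f g → T (⁅ p ⁆ f) → T (⁅ p ⁆ g) → ¬ T (A f g)
  singleton-independent A-irr p f g Ff Fg with ∈⁅⁆ p f Ff | ∈⁅⁆ p g Fg
  ... | refl | refl = A-irr p

  pair-independent : ∀ {A p q} → IsSymmetric A → IsIrreflexive A → ¬ T (A p q) →
                     ∀ f g → T (⁅ p ⁆∪⁅ q ⁆ f) → T (⁅ p ⁆∪⁅ q ⁆ g) → ¬ T (A f g)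
  pair-independent {p = p} {q} A-sym A-irr p≁q f g Ff Fg with ∈⁅⁆∪⁅⁆ p q f Ff | ∈⁅⁆∪⁅⁆ p q g Fg
  ... | inj₁ refl | inj₁ refl = A-irr f
  ... | inj₁ refl | inj₂ refl = p≁q
  ... | inj₂ refl | inj₁ refl = p≁q ∘ subst T (A-sym f g)
  ... | inj₂ refl | inj₂ refl = A-irr f

  -- If the lists of p and q share a colour, both get it; otherwise L p ++ L q has more than
  -- b r colours, so one of them is missing from L r, and giving it to p or q costs r nothing.
  diamond : ∀ {A b p q r} → IsSymmetric A → IsIrreflexive A → ¬ T (A p q) → b r < b p + b q →
            Choosable (isolate ⁅ p ⁆∪⁅ q ⁆ A) (precolouredBounds A ⁅ p ⁆∪⁅ q ⁆ ∅ b) →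
            Choosable (isolate ⁅ p ⁆ A) (precolouredBounds A ⁅ p ⁆ ⁅ r ⁆ b) →
            Choosable (isolate ⁅ q ⁆ A) (precolouredBounds A ⁅ q ⁆ ⁅ r ⁆ b) →
            Choosable A b
  diamond {A} {b} {p} {q} {r} A-sym A-irr p≁q fewer both onlyP onlyQ = exact-choosable λ M M-exact →
    let M-fits : IsListAssignment b M
        M-fits i = proj₁ (M-exact i) , ≤-reflexive (sym (proj₂ (M-exact i)))
    in case Any.any? (ℕ-Membership._∈? M q) (M p) of λ where
      (yes common) →
        let c , c∈Mp , c∈Mq = find common in
        Product.map₂ proj₁ (precolour A-sym (pair-independent A-sym A-irr p≁q) both M-fits c
          (λ f Ff → [ (λ { refl → c∈Mp }) , (λ { refl → c∈Mq }) ]′ (∈⁅⁆∪⁅⁆ p q f Ff)) (λ _ ()))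
      (no disjoint) →
        let γ , γ∈Mp++Mq , γ∉Mr =
              pigeonhole (++⁺ (proj₁ (M-exact p)) (proj₁ (M-exact q)) (λ (γ∈Mp , γ∈Mq) → disjoint (lose γ∈Mp γ∈Mq)))
                (begin-strict
                  length (M r)                ≡⟨ proj₂ (M-exact r) ⟩
                  b r                         <⟨ fewer ⟩
                  b p + b q                   ≡⟨ sym (cong₂ _+_ (proj₂ (M-exact p)) (proj₂ (M-exact q))) ⟩
                  length (M p) + length (M q) ≡⟨ sym (length-++ (M p)) ⟩
                  length (M p ++ M q)         ∎)
        in case ∈-++⁻ (M p) γ∈Mp++Mq of λ where
          (inj₁ γ∈Mp) → Product.map₂ proj₁ (precolour A-sym (singleton-independent A-irr p) onlyP M-fits γ
                          (⁅⁆-elim p γ∈Mp) (⁅⁆-elim {λ x → γ ∉ M x} r γ∉Mr))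
          (inj₂ γ∈Mq) → Product.map₂ proj₁ (precolour A-sym (singleton-independent A-irr q) onlyQ M-fits γ
                          (⁅⁆-elim q γ∈Mq) (⁅⁆-elim {λ x → γ ∉ M x} r γ∉Mr))
    where open ≤-Reasoning

-- A certified search for list colourings

module _ {k : ℕ} where

  choosable? : ℕ → Adjacency k → (Fin k → ℕ) → Bool
  search? : ℕ → Adjacency k → (Fin k → ℕ) → Bool
  diamond? : ℕ → Adjacency k → (Fin k → ℕ) → Fin k → Fin k → Fin k → Bool
  precoloured? : ℕ → Adjacency k → (F X : Fin k → Bool) → (Fin k → ℕ) → Bool

  -- Tabulating the bounds makes the search evaluate each of them only once.
  choosable? d A b = search? d A (Vec.lookup (Vec.tabulate b))

  search? zero    A b = greedy? A b
  search? (suc d) A b =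
    greedy? A b ∨ any (λ p → any (λ q → any (diamond? d A b p q) (allFin k)) (allFin k)) (allFin k)

  -- Only p ≁ q, b r < b p + b q and the three reductions matter for soundness; the other
  -- conjuncts prune the search.
  diamond? d A b p q r =
    (toℕ p <ᵇ toℕ q) ∧ not (A p q) ∧ A p r ∧ A q r ∧ (b r <ᵇ b p + b q) ∧
    precoloured? d A ⁅ p ⁆∪⁅ q ⁆ ∅ b ∧ precoloured? d A ⁅ p ⁆ ⁅ r ⁆ b ∧ precoloured? d A ⁅ q ⁆ ⁅ r ⁆ b

  precoloured? d A F X b = choosable? d (isolate F A) (precolouredBounds A F X b)

  choosable-sound : ∀ d {A b} → IsSymmetric A → IsIrreflexive A → T (choosable? d A b) → Choosable A b
  search-sound : ∀ d {A b} → IsSymmetric A → IsIrreflexive A → T (search? d A b) → Choosable A b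
  diamond-sound : ∀ d {A b p q r} → IsSymmetric A → IsIrreflexive A → T (diamond? d A b p q r) → Choosable A b
  precoloured-sound : ∀ d {A} F {X b} → IsSymmetric A → IsIrreflexive A → T (precoloured? d A F X b) →
                      Choosable (isolate F A) (precolouredBounds A F X b)

  choosable-sound d {b = b} A-sym A-irr ok =
    choosable-resp-≗ (Vec.lookup∘tabulate b) (search-sound d A-sym A-irr ok)

  search-sound zero A-sym A-irr ok = greedy-choosable A-sym A-irr ok
  search-sound (suc d) {A} {b} A-sym A-irr ok with Equivalence.to T-∨ ok
  ... | inj₁ greedy-ok = greedy-choosable A-sym A-irr greedy-ok
  ... | inj₂ found =
    let p , found-p = any-witness _ (allFin k) found
        q , found-q = any-witness _ (allFin k) found-p
        r , found-r = any-witness _ (allFin k) found-q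
    in diamond-sound d {A} {b} {p} {q} {r} A-sym A-irr found-r

  diamond-sound d {A} {b} {p} {q} {r} A-sym A-irr ok =
    let _ , ok₁       = T-∧⁻ (toℕ p <ᵇ toℕ q) ok
        p≁q , ok₂     = T-∧⁻ (not (A p q)) ok₁
        _ , ok₃       = T-∧⁻ (A p r) ok₂
        _ , ok₄       = T-∧⁻ (A q r) ok₃
        fewer , ok₅   = T-∧⁻ (b r <ᵇ b p + b q) ok₄
        both , ok₆    = T-∧⁻ (precoloured? d A ⁅ p ⁆∪⁅ q ⁆ ∅ b) ok₅
        onlyP , onlyQ = T-∧⁻ (precoloured? d A ⁅ p ⁆ ⁅ r ⁆ b) ok₆
    in diamond A-sym A-irr (T-not⁻ p≁q) (<ᵇ⇒< _ _ fewer)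
         (precoloured-sound d ⁅ p ⁆∪⁅ q ⁆ A-sym A-irr both)
         (precoloured-sound d ⁅ p ⁆ A-sym A-irr onlyP)
         (precoloured-sound d ⁅ q ⁆ A-sym A-irr onlyQ)

  precoloured-sound d {A} F A-sym A-irr =
    choosable-sound d (isolate-sym F A-sym) (isolate-irr {A = A} F A-irr)

  -- FORB is checked only for pairs with u ≤ w; the other pairs follow by symmetry.
  reducible? : ℕ → Adjacency k → (Fin k → ℕ) → Bool
  reducible? d A b =
    all (λ u → precoloured? d A ⁅ u ⁆ ∅ b) (allFin k) ∧
    all (λ u → all (λ w → (toℕ w <ᵇ toℕ u) ∨ choosable? d A (decrementedAt ⁅ u ⁆∪⁅ w ⁆ b)) (allFin k)) (allFin k)

  module FixForbid {d A b L} (A-sym : IsSymmetric A) (A-irr : IsIrreflexive A)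
                   (ok : T (reducible? d A b)) (L-fits : IsListAssignment b L) where

    fixing : ∀ u {α} → α ∈ L u → ∃ λ ψ → IsProperColouring A L ψ × ψ u ≡ α
    fixing u {α} α∈Lu =
      let fix-u = precoloured-sound d ⁅ u ⁆ A-sym A-irr (all-allFin⁻ _ (proj₁ (T-∧⁻ _ ok)) u)
          ψ , proper , onF = precolour A-sym (singleton-independent A-irr u) fix-u L-fits α (⁅⁆-elim u α∈Lu) (λ _ ())
      in ψ , proper , onF u (⁅⁆-∋ u)

    avoiding : ∀ u w γ → T (choosable? d A (decrementedAt ⁅ u ⁆∪⁅ w ⁆ b)) →
               ∃ λ ψ → IsProperColouring A L ψ × ψ u ≢ γ × ψ w ≢ γ
    avoiding u w γ ok-uw =
      let ψ , proper , avoids = avoid (choosable-sound d A-sym A-irr ok-uw) L-fits γ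
      in ψ , proper , avoids u (⁅⁆∪⁅⁆-∋ˡ u w) , avoids w (⁅⁆∪⁅⁆-∋ʳ u w)

    entry : ∀ u w → T ((toℕ w <ᵇ toℕ u) ∨ choosable? d A (decrementedAt ⁅ u ⁆∪⁅ w ⁆ b))
    entry u w = all-allFin⁻ _ (all-allFin⁻ _ (proj₂ (T-∧⁻ _ ok)) u) w

    forbidding : ∀ u w γ → ∃ λ ψ → IsProperColouring A L ψ × ψ u ≢ γ × ψ w ≢ γ
    forbidding u w γ with Equivalence.to T-∨ (entry u w) | Equivalence.to T-∨ (entry w u)
    ... | inj₂ ok-uw | _          = avoiding u w γ ok-uw
    ... | inj₁ _     | inj₂ ok-wu = Product.map₂ (Product.map₂ Product.swap) (avoiding w u γ ok-wu)
    ... | inj₁ w<u   | inj₁ u<w   = ⊥-elim (<-asym (<ᵇ⇒< (toℕ w) (toℕ u) w<u) (<ᵇ⇒< (toℕ u) (toℕ w) u<w))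

-- Configurations with partially known adjacency

Triangle : ℕ → Set → Set
Triangle zero    X = ⊤
Triangle (suc k) X = Vec X k × Triangle k X

fromTriangle : ∀ {k} → Triangle k Bool → Adjacency k
fromTriangle {suc k} (row , rest) zero    zero    = false
fromTriangle {suc k} (row , rest) zero    (suc j) = Vec.lookup row j
fromTriangle {suc k} (row , rest) (suc i) zero    = Vec.lookup row i
fromTriangle {suc k} (row , rest) (suc i) (suc j) = fromTriangle rest i j

triangleOf : ∀ {k} → Adjacency k → Triangle k Bool
triangleOf {zero}  A = tt
triangleOf {suc k} A = Vec.tabulate (A zero ∘ suc) , triangleOf (λ i j → A (suc i) (suc j))

fromTriangle-triangleOf : ∀ {k} {A : Adjacency k} → IsSymmetric A → IsIrreflexive A →
                          ∀ i j → fromTriangle (triangleOf A) i j ≡ A i j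
fromTriangle-triangleOf A-sym A-irr zero    zero    = sym (Equivalence.to T-not-≡ (T-not⁺ (A-irr zero)))
fromTriangle-triangleOf A-sym A-irr zero    (suc j) = Vec.lookup∘tabulate _ j
fromTriangle-triangleOf A-sym A-irr (suc i) zero    = trans (Vec.lookup∘tabulate _ i) (A-sym zero (suc i))
fromTriangle-triangleOf A-sym A-irr (suc i) (suc j) =
  fromTriangle-triangleOf (λ i j → A-sym (suc i) (suc j)) (λ i → A-irr (suc i)) i j

Pattern : ℕ → Set
Pattern k = Triangle k (Maybe Bool)

Agrees : Maybe Bool → Bool → Set
Agrees (just true)  x = T x
Agrees (just false) x = ¬ T x
Agrees nothing      _ = ⊤

Matches : ∀ {k} → Pattern k → Triangle k Bool → Set
Matches {zero}  _        _         = ⊤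
Matches {suc k} (ps , P) (row , t) = Pointwise Agrees ps row × Matches P t

options : Maybe Bool → List Bool
options (just b) = [ b ]
options nothing  = true ∷ false ∷ []

rowCompletions : ∀ {m} → Vec (Maybe Bool) m → List (Vec Bool m)
rowCompletions []       = [ [] ]
rowCompletions (p ∷ ps) = cartesianProductWith _∷_ (options p) (rowCompletions ps)

completions : ∀ {k} → Pattern k → List (Triangle k Bool)
completions {zero}  _        = [ tt ]
completions {suc k} (ps , P) = cartesianProductWith _,_ (rowCompletions ps) (completions P)

∈-options : ∀ p {x} → Agrees p x → x ∈ options p
∈-options (just true)  {true}  _  = here refl
∈-options (just false) {true}  ¬t = ⊥-elim (¬t tt)
∈-options (just false) {false} _  = here refl
∈-options nothing      {true}  _  = here refl
∈-options nothing      {false} _  = there (here refl)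

∈-rowCompletions : ∀ {m} {ps : Vec (Maybe Bool) m} {row} → Pointwise Agrees ps row → row ∈ rowCompletions ps
∈-rowCompletions              []       = here refl
∈-rowCompletions {ps = p ∷ _} (a ∷ as) = ∈-cartesianProductWith⁺ _∷_ (∈-options p a) (∈-rowCompletions as)

∈-completions : ∀ {k} {P : Pattern k} {t} → Matches P t → t ∈ completions P
∈-completions {zero}  _        = here refl
∈-completions {suc k} (as , m) = ∈-cartesianProductWith⁺ _,_ (∈-rowCompletions as) (∈-completions m)

degree : ∀ {k} → Adjacency k → Fin k → ℕ
degree {k} A i = count (A i) (allFin k)

listSizes : ∀ {k} → Adjacency k → Vec ℕ k → Fin k → ℕ
listSizes A ds i = (4 + degree A i) ∸ Vec.lookup ds i

feasible : ∀ {k} → Adjacency k → Vec ℕ k → Bool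
feasible {k} A ds = all (λ i → degree A i ≤ᵇ Vec.lookup ds i) (allFin k)

certified : ∀ {k} → Pattern k → Vec ℕ k → Bool
certified P ds =
  all (λ t → let A = fromTriangle t in not (feasible A ds) ∨ reducible? 1 A (listSizes A ds)) (completions P)

certified-sound : ∀ {k} {P : Pattern k} {ds t} → T (certified P ds) → Matches P t → T (feasible (fromTriangle t) ds) →
                  T (reducible? 1 (fromTriangle t) (listSizes (fromTriangle t) ds))
certified-sound {P = P} ok matches feasible
  with Equivalence.to T-∨ (All.lookup (all⁺ _ (completions P) ok) (∈-completions matches))
... | inj₁ infeasible = ⊥-elim (T-not⁻ infeasible feasible)
... | inj₂ reducible  = reducible

uniform : ∀ {n} → ℚ → List (Fin n → ℕ) → Distribution n
uniform p = map (_, p)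

totalMass-uniform : ∀ {n} p (φs : List (Fin n → ℕ)) → totalMass (uniform p φs) ≡ length φs ×ℚ p
totalMass-uniform p []       = refl
totalMass-uniform p (φ ∷ φs) = cong (p ℚ.+_) (totalMass-uniform p φs)

≤-+-nonnegˡ : ∀ {p q r} → 0ℚ ℚ.≤ q → p ℚ.≤ r → p ℚ.≤ q ℚ.+ r
≤-+-nonnegˡ {p} {q} {r} 0≤q p≤r = subst (ℚ._≤ q ℚ.+ r) (ℚ.+-identityˡ p) (ℚ.+-mono-≤ 0≤q p≤r)

≤-+-nonnegʳ : ∀ {p q r} → p ℚ.≤ q → 0ℚ ℚ.≤ r → p ℚ.≤ q ℚ.+ r
≤-+-nonnegʳ {p} {q} {r} p≤q 0≤r = subst (ℚ._≤ q ℚ.+ r) (ℚ.+-identityʳ p) (ℚ.+-mono-≤ p≤q 0≤r)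

module _ {n} {p : ℚ} (0≤p : 0ℚ ℚ.≤ p) (E : (Fin n → ℕ) → Bool) where

  weight-nonneg : ∀ φ → 0ℚ ℚ.≤ (if E φ then p else 0ℚ)
  weight-nonneg φ with E φ
  ... | true  = 0≤p
  ... | false = ℚ.≤-refl

  Pr-uniform-nonneg : ∀ φs → 0ℚ ℚ.≤ Pr (uniform p φs) E
  Pr-uniform-nonneg []       = ℚ.≤-refl
  Pr-uniform-nonneg (φ ∷ φs) = ≤-+-nonnegˡ (weight-nonneg φ) (Pr-uniform-nonneg φs)

  Pr-uniform-≥ : ∀ {φs} → Any (T ∘ E) φs → p ℚ.≤ Pr (uniform p φs) E
  Pr-uniform-≥ {φ ∷ φs} (here Eφ) with E φ
  ... | true = ≤-+-nonnegʳ ℚ.≤-refl (Pr-uniform-nonneg φs)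
  Pr-uniform-≥ {φ ∷ φs} (there E∈φs) = ≤-+-nonnegˡ (weight-nonneg φ) (Pr-uniform-≥ E∈φs)

record WitnessFamily {n} (G : Graph n) (S : VSet n) (L : Fin n → List ℕ) (N : ℕ) : Set where
  field
    members    : List (Fin n → ℕ)
    size       : length members ≡ N
    colourings : All (IsLColoring G S L) members
    fixes      : ∀ v c → T (S v) → c ∈ L v → Any (λ φ → φ v ≡ c) members
    forbids    : ∀ u w c → T (S u) → T (S w) → c ∈ L u ⊎ c ∈ L w → Any (λ φ → φ u ≢ c × φ w ≢ c) members

uniform-reducible : ∀ {n} (G : Graph n) (S : VSet n) {ξ p : ℚ} (N : ℕ) → 0ℚ ℚ.≤ p → ξ ℚ.≤ p → N ×ℚ p ≡ 1ℚ →
                    (∀ L → IsAssignment G S L → WitnessFamily G S L N) → Reducible G S ξ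
uniform-reducible G S {p = p} N 0≤p ξ≤p mass witnesses L L-assignment =
  uniform p members ,
  (All-map⁺ (All.map (_, 0≤p) colourings) , trans (totalMass-uniform p members) (trans (cong (_×ℚ p) size) mass)) ,
  (λ v c Sv c∈Lv → ℚ.≤-trans ξ≤p (Pr-uniform-≥ 0≤p _ (Any.map (≡⇒≡ᵇ _ _) (fixes v c Sv c∈Lv)))) ,
  (λ u w c Su Sw c∈ → ℚ.≤-trans ξ≤p (Pr-uniform-≥ 0≤p _ (Any.map (avoids u w c) (forbids u w c Su Sw c∈))))
  where
    open WitnessFamily (witnesses L L-assignment)
    avoids : ∀ u w c {φ : Fin _ → ℕ} → φ u ≢ c × φ w ≢ c → T (not (φ u =ᵇ c) ∧ not (φ w =ᵇ c))
    avoids u w c (φu≢c , φw≢c) = Equivalence.from T-∧ (T-not⁺ (φu≢c ∘ ≡ᵇ⇒≡ _ _) , T-not⁺ (φw≢c ∘ ≡ᵇ⇒≡ _ _))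

module Embedding {n k} (G : Graph n) (vs : Vec (Fin n) k) where

  vertex : Fin k → Fin n
  vertex = Vec.lookup vs

  inducedSet : VSet n
  inducedSet w = ⌊ any? (λ i → vertex i ≟ w) ⌋

  induced : Adjacency k
  induced i j = adj G (vertex i) (vertex j)

  induced-sym : IsSymmetric induced
  induced-sym i j = Graph.sym G (vertex i) (vertex j)

  induced-irr : IsIrreflexive induced
  induced-irr i = subst T (irrefl G (vertex i))

  vertex∈inducedSet : ∀ i → T (inducedSet (vertex i))
  vertex∈inducedSet i = fromWitness (i , refl)

  inducedSet⇒vertex : ∀ {w} → T (inducedSet w) → ∃ λ i → vertex i ≡ w
  inducedSet⇒vertex = toWitness

  extend : (Fin k → ℕ) → Fin n → ℕ
  extend ψ w with any? (λ i → vertex i ≟ w)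
  ... | yes (i , _) = ψ i
  ... | no _        = 0

  degIn≤deg : ∀ u → degIn G inducedSet u ≤ deg G u
  degIn≤deg u = begin
    degIn G inducedSet u                              ≡⟨ sum-indicator≡count _ (allFin n) ⟩
    count (λ w → adj G u w ∧ inducedSet w) (allFin n) ≤⟨ unique-⊆⇒length-≤ (filter⁺ _ (allFin⁺ n)) neighbours⊆ ⟩
    count (λ w → adj G u w ∧ true) (allFin n)         ≡⟨ sym (sum-indicator≡count _ (allFin n)) ⟩
    deg G u                                           ∎
    where
      open ≤-Reasoning
      neighbours⊆ : filterᵇ (λ w → adj G u w ∧ inducedSet w) (allFin n) ⊆ filterᵇ (λ w → adj G u w ∧ true) (allFin n)
      neighbours⊆ {w} w∈ = ∈-filter⁺ _ (∈-allFin w)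
        (Equivalence.from T-∧ (proj₁ (T-∧⁻ (adj G u w) (proj₂ (∈-filter⁻ _ {xs = allFin n} w∈))) , _))

  ℓ≤4 : ∀ u → ℓ G inducedSet u ≤ 4
  ℓ≤4 u = begin
    (4 + degIn G inducedSet u) ∸ deg G u                  ≤⟨ ∸-monoʳ-≤ (4 + degIn G inducedSet u) (degIn≤deg u) ⟩
    (4 + degIn G inducedSet u) ∸ degIn G inducedSet u     ≡⟨ m+n∸n≡m 4 (degIn G inducedSet u) ⟩
    4                                                     ∎
    where open ≤-Reasoning

  module Induced (distinct : UniqueVec vs) {A : Adjacency k} (A≡induced : ∀ i j → A i j ≡ induced i j)
                 {ds : Vec ℕ k} (degrees : Pointwise (λ v d → deg G v ≡ d) vs ds) where

    vertex-injective : ∀ {i j} → vertex i ≡ vertex j → i ≡ j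
    vertex-injective = lookup-injective distinct _ _

    extend-vertex : ∀ ψ i → extend ψ (vertex i) ≡ ψ i
    extend-vertex ψ i with any? (λ j → vertex j ≟ vertex i)
    ... | yes (j , vj≡vi) = cong ψ (vertex-injective vj≡vi)
    ... | no ∄j           = ⊥-elim (∄j (i , refl))

    A-sym : IsSymmetric A
    A-sym i j = trans (A≡induced i j) (trans (induced-sym i j) (sym (A≡induced j i)))

    A-irr : IsIrreflexive A
    A-irr i = induced-irr i ∘ subst T (A≡induced i i)

    degree≤degIn : ∀ i → degree A i ≤ degIn G inducedSet (vertex i)
    degree≤degIn i = begin
      degree A i                                 ≡⟨ sym (length-map vertex neighbours) ⟩
      length (map vertex neighbours)             ≤⟨ unique-⊆⇒length-≤ unique neighbours⊆ ⟩
      count (λ w → adj G (vertex i) w ∧ inducedSet w) (allFin n) ≡⟨ sym (sum-indicator≡count _ (allFin n)) ⟩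
      degIn G inducedSet (vertex i)              ∎
      where
        open ≤-Reasoning
        neighbours = filterᵇ (A i) (allFin k)
        unique = Unique-map⁺ vertex-injective (filter⁺ _ (allFin⁺ k))
        neighbours⊆ : map vertex neighbours ⊆ filterᵇ (λ w → adj G (vertex i) w ∧ inducedSet w) (allFin n)
        neighbours⊆ w∈ with ∈-map⁻ vertex w∈
        ... | j , j∈ , refl = ∈-filter⁺ _ (∈-allFin (vertex j)) (Equivalence.from T-∧
          (subst T (A≡induced i j) (proj₂ (∈-filter⁻ _ {xs = allFin k} j∈)) , vertex∈inducedSet j))

    deg≡ : ∀ i → deg G (vertex i) ≡ Vec.lookup ds i
    deg≡ = Pointwise.lookup degrees

    feasible-induced : T (feasible A ds)
    feasible-induced = all⁻ _ {xs = allFin k} (All.tabulate λ {i} _ → ≤⇒≤ᵇ (begin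
      degree A i                    ≤⟨ degree≤degIn i ⟩
      degIn G inducedSet (vertex i) ≤⟨ degIn≤deg (vertex i) ⟩
      deg G (vertex i)              ≡⟨ deg≡ i ⟩
      Vec.lookup ds i               ∎))
      where open ≤-Reasoning

    listSizes≤ℓ : ∀ i → listSizes A ds i ≤ ℓ G inducedSet (vertex i)
    listSizes≤ℓ i = subst (λ d → (4 + degree A i) ∸ d ≤ ℓ G inducedSet (vertex i)) (deg≡ i)
                      (∸-monoˡ-≤ (deg G (vertex i)) (+-monoʳ-≤ 4 (degree≤degIn i)))

    extend-colouring : ∀ {L ψ} → IsProperColouring A (L ∘ vertex) ψ → IsLColoring G inducedSet L (extend ψ)
    extend-colouring {L} {ψ} (inM , proper) = inL , properL
      where
        inL : ∀ v → T (inducedSet v) → extend ψ v ∈ L v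
        inL v Sv with inducedSet⇒vertex Sv
        ... | i , refl = subst (_∈ L (vertex i)) (sym (extend-vertex ψ i)) (inM i)

        properL : ∀ u v → T (inducedSet u) → T (inducedSet v) → T (adj G u v) → extend ψ u ≢ extend ψ v
        properL u v Su Sv uv with inducedSet⇒vertex Su | inducedSet⇒vertex Sv
        ... | i , refl | j , refl = subst₂ _≢_ (sym (extend-vertex ψ i)) (sym (extend-vertex ψ j))
                                      (proper i j (subst T (sym (A≡induced i j)) uv))

    -- Lists have at most 4 colours, so padding each block of colourings to 4 (one vertex fixed) or
    -- 8 (two vertices forbidden) gives k·4 + k·k·8 colourings whatever the list assignment is.
    module Family {d} (ok : T (reducible? d A (listSizes A ds))) (L : Fin n → List ℕ)
                  (L-assignment : IsAssignment G inducedSet L) where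

      M : ListAssignment k
      M = L ∘ vertex

      length-M : ∀ i → length (M i) ≡ ℓ G inducedSet (vertex i)
      length-M i = proj₂ (L-assignment (vertex i) (vertex∈inducedSet i))

      length-M≤4 : ∀ i → length (M i) ≤ 4
      length-M≤4 i = subst (_≤ 4) (sym (length-M i)) (ℓ≤4 (vertex i))

      M-fits : IsListAssignment (listSizes A ds) M
      M-fits i = proj₁ (L-assignment (vertex i) (vertex∈inducedSet i)) ,
                 subst (listSizes A ds i ≤_) (sym (length-M i)) (listSizes≤ℓ i)

      open FixForbid {d = d} A-sym A-irr ok M-fits

      ProperColouring : Set
      ProperColouring = ∃ (IsProperColouring A M)

      fallback : Fin k → ProperColouring
      fallback u = Product.map₂ proj₁ (forbidding u u 0)

      fixings : Fin k → List ProperColouring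
      fixings u = mapWith∈ (M u) (Product.map₂ proj₁ ∘ fixing u)

      forbiddings : Fin k → Fin k → List ProperColouring
      forbiddings u w = map (Product.map₂ proj₁ ∘ forbidding u w) (M u ++ M w)

      fixBlock : Fin k → List ProperColouring
      fixBlock u = pad 4 (fallback u) (fixings u)

      forbidBlock : Fin k → Fin k → List ProperColouring
      forbidBlock u w = pad 8 (fallback u) (forbiddings u w)

      forbidBlocks : Fin k → List ProperColouring
      forbidBlocks u = concatMap (forbidBlock u) (allFin k)

      family : List ProperColouring
      family = concatMap fixBlock (allFin k) ++ concatMap forbidBlocks (allFin k)

      length-fixBlock : ∀ u → length (fixBlock u) ≡ 4
      length-fixBlock u = length-pad (fallback u) (fixings u)
        (subst (_≤ 4) (sym (SetoidMembership.length-mapWith∈ (setoid ℕ) (M u))) (length-M≤4 u))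

      length-forbidBlock : ∀ u w → length (forbidBlock u w) ≡ 8
      length-forbidBlock u w = length-pad (fallback u) (forbiddings u w)
        (subst (_≤ 8) (sym (trans (length-map _ (M u ++ M w)) (length-++ (M u))))
               (+-mono-≤ (length-M≤4 u) (length-M≤4 w)))

      length-family : length family ≡ k * 4 + k * (k * 8)
      length-family = begin
        length family
          ≡⟨ length-++ (concatMap fixBlock (allFin k)) ⟩
        length (concatMap fixBlock (allFin k)) + length (concatMap forbidBlocks (allFin k))
          ≡⟨ cong₂ _+_ (length-concatMap fixBlock length-fixBlock (allFin k))
                       (length-concatMap forbidBlocks length-forbidBlocks (allFin k)) ⟩
        length (allFin k) * 4 + length (allFin k) * (k * 8)
          ≡⟨ cong (λ m → m * 4 + m * (k * 8)) length-allFin ⟩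
        k * 4 + k * (k * 8) ∎
        where
          open ≡-Reasoning
          length-allFin : length (allFin k) ≡ k
          length-allFin = length-tabulate (λ i → i)
          length-forbidBlocks : ∀ u → length (forbidBlocks u) ≡ k * 8
          length-forbidBlocks u = trans (length-concatMap (forbidBlock u) (length-forbidBlock u) (allFin k))
                                        (cong (_* 8) length-allFin)

      fixes : ∀ i {c} → c ∈ M i → Any (λ x → extend (proj₁ x) (vertex i) ≡ c) family
      fixes i {c} c∈Mi = ++⁺ˡ (concat⁺ (Any-map⁺ (lose (∈-allFin i) (++⁺ˡ (mapWith∈⁺ _ (c , c∈Mi , fixed))))))
        where
          fixed : extend (proj₁ (fixing i c∈Mi)) (vertex i) ≡ c
          fixed = trans (extend-vertex _ i) (proj₂ (proj₂ (fixing i c∈Mi)))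

      forbids : ∀ i j {c} → c ∈ M i ⊎ c ∈ M j →
                Any (λ x → extend (proj₁ x) (vertex i) ≢ c × extend (proj₁ x) (vertex j) ≢ c) family
      forbids i j {c} c∈ = ++⁺ʳ (concatMap fixBlock (allFin k))
        (concat⁺ (Any-map⁺ (lose (∈-allFin i) (concat⁺ (Any-map⁺ (lose (∈-allFin j)
          (++⁺ˡ (Any-map⁺ (lose ([ ∈-++⁺ˡ , ∈-++⁺ʳ (M i) ]′ c∈) avoided)))))))))
        where
          ψ = proj₁ (forbidding i j c)
          avoided : extend ψ (vertex i) ≢ c × extend ψ (vertex j) ≢ c
          avoided = let _ , _ , ψi≢c , ψj≢c = forbidding i j c in
            subst (_≢ c) (sym (extend-vertex ψ i)) ψi≢c , subst (_≢ c) (sym (extend-vertex ψ j)) ψj≢c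

      witnesses : WitnessFamily G inducedSet L (k * 4 + k * (k * 8))
      witnesses = record
        { members    = map (extend ∘ proj₁) family
        ; size       = trans (length-map _ family) length-family
        ; colourings = All-map⁺ (All.universal (extend-colouring ∘ proj₂) family)
        ; fixes      = λ v c Sv c∈Lv → case inducedSet⇒vertex Sv of λ { (i , refl) → Any-map⁺ (fixes i c∈Lv) }
        ; forbids    = λ u w c Su Sw c∈ → case inducedSet⇒vertex Su , inducedSet⇒vertex Sw of λ
                         { ((i , refl) , (j , refl)) → Any-map⁺ (forbids i j c∈) }
        }

configuration-reducible :
  ∀ {k} (P : Pattern k) (ds : Vec ℕ k) → T (certified P ds) →
  ∀ {n} (G : Graph n) (vs : Vec (Fin n) k) → UniqueVec vs → Pointwise (λ v d → deg G v ≡ d) vs ds →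
  Matches P (triangleOf (Embedding.induced G vs)) →
  ∀ {ξ p} → 0ℚ ℚ.≤ p → ξ ℚ.≤ p → (k * 4 + k * (k * 8)) ×ℚ p ≡ 1ℚ → Reducible G (Embedding.inducedSet G vs) ξ
configuration-reducible P ds certificate G vs distinct degrees matches 0≤p ξ≤p mass =
  uniform-reducible G inducedSet _ 0≤p ξ≤p mass (Family.witnesses {1} ok)
  where
    open Embedding G vs
    open Induced distinct (fromTriangle-triangleOf induced-sym induced-irr) degrees
    ok = certified-sound {P = P} {ds} certificate matches feasible-induced

-- Around a stressed vertex

degrees₆ : Vec ℕ 6
degrees₆ = 4 ∷ 4 ∷ 4 ∷ 4 ∷ 3 ∷ 3 ∷ []

degrees₇ : Vec ℕ 7
degrees₇ = 4 ∷ 4 ∷ 4 ∷ 4 ∷ 3 ∷ 3 ∷ 3 ∷ []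

-- Row by row, the adjacencies of v, a, b, c, x, y (and z) to the later vertices; `nothing` is unknown.
pattern-ax : Pattern 6
pattern-ax =
  (just true ∷ just true ∷ nothing ∷ just true ∷ just true ∷ []) ,
  (just true ∷ just true ∷ just true ∷ nothing ∷ []) ,
  (just true ∷ nothing ∷ nothing ∷ []) ,
  (nothing ∷ nothing ∷ []) ,
  (nothing ∷ []) ,
  [] , _

pattern-cx : Pattern 6
pattern-cx =
  (just true ∷ just true ∷ nothing ∷ just true ∷ just true ∷ []) ,
  (just true ∷ just true ∷ nothing ∷ nothing ∷ []) ,
  (just true ∷ nothing ∷ nothing ∷ []) ,
  (just true ∷ nothing ∷ []) ,
  (nothing ∷ []) ,
  [] , _

pattern-z : Pattern 7
pattern-z =
  (just true ∷ just true ∷ nothing ∷ just true ∷ just true ∷ nothing ∷ []) ,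
  (just true ∷ just true ∷ just false ∷ just false ∷ just true ∷ []) ,
  (just true ∷ just false ∷ just false ∷ nothing ∷ []) ,
  (just false ∷ just false ∷ nothing ∷ []) ,
  (nothing ∷ nothing ∷ []) ,
  (nothing ∷ []) ,
  [] , _

module _ {n} (G : Graph n) where

  Edge : Fin n → Fin n → Set
  Edge u w = T (adj G u w)

  edge-sym : ∀ {u w} → Edge u w → Edge w u
  edge-sym {u} {w} = subst T (Graph.sym G u w)

  edge⇒≢ : ∀ {u w} → Edge u w → u ≢ w
  edge⇒≢ {u} uw refl = subst T (irrefl G u) uw

  degree⇒≢ : ∀ {u w} → deg G u ≡ 4 → deg G w ≡ 3 → u ≢ w
  degree⇒≢ du dw refl with trans (sym du) dw
  ... | ()

  stressed≢conductive : ∀ {v c} → Stressed G v → Conductive G c → v ≢ c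
  stressed≢conductive (_ , two) (_ , one) refl with trans (sym one) two
  ... | ()

  Degree3Neighbour : Fin n → Fin n → Set
  Degree3Neighbour v u = Edge v u × deg G u ≡ 3

  degree3Neighbours : Fin n → List (Fin n)
  degree3Neighbours v = filterᵇ (λ u → adj G v u ∧ (deg G u =ᵇ 3)) (allFin n)

  degree3Neighbours-all : ∀ v → All (Degree3Neighbour v) (degree3Neighbours v)
  degree3Neighbours-all v = All.map degree3Neighbour (all-filter (T? ∘ (λ u → adj G v u ∧ (deg G u =ᵇ 3))) (allFin n))
    where
      degree3Neighbour : ∀ {u} → T (adj G v u ∧ (deg G u =ᵇ 3)) → Degree3Neighbour v u
      degree3Neighbour {u} t = let e , d = T-∧⁻ (adj G v u) t in e , ≡ᵇ⇒≡ (deg G u) 3 d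

  degree3Neighbours-unique : ∀ v → Unique (degree3Neighbours v)
  degree3Neighbours-unique v = filter⁺ _ (allFin⁺ n)

  length-degree3Neighbours : ∀ v → length (degree3Neighbours v) ≡ deg3Nbrs G v
  length-degree3Neighbours v = sym (sum-indicator≡count _ (allFin n))

  one-degree3-neighbour : ∀ v → deg3Nbrs G v ≡ 1 → ∃ (Degree3Neighbour v)
  one-degree3-neighbour v one
    with degree3Neighbours v | degree3Neighbours-all v | trans (length-degree3Neighbours v) one
  ... | x ∷ [] | x₃ ∷ [] | refl = x , x₃

  two-degree3-neighbours : ∀ v → deg3Nbrs G v ≡ 2 → ∃₂ λ x y → x ≢ y × Degree3Neighbour v x × Degree3Neighbour v y
  two-degree3-neighbours v two
    with degree3Neighbours v | degree3Neighbours-all v | degree3Neighbours-unique v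
       | trans (length-degree3Neighbours v) two
  ... | x ∷ y ∷ [] | x₃ ∷ y₃ ∷ [] | (x≢y ∷ []) ∷ _ | refl = x , y , x≢y , x₃ , y₃

  record ReducibleConfiguration (ξ : ℚ) : Set where
    constructor reducible-at
    field
      {size}    : ℕ
      vertices  : Vec (Fin n) (suc size)
      reducible : Reducible G (Embedding.inducedSet G vertices) ξ

  no-reducible-configuration : ∀ {ξ} → (∀ S → NonEmpty S → ¬ Reducible G S ξ) → ¬ ReducibleConfiguration ξ
  no-reducible-configuration irreducible (reducible-at vs reducible) =
    irreducible _ (Vec.lookup vs zero , Embedding.vertex∈inducedSet G vs zero) reducible

  record StressedAtTriangle (v a b c x y : Fin n) : Set where
    field
      va : Edge v a
      vb : Edge v b
      vx : Edge v x
      vy : Edge v y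
      ab : Edge a b
      ac : Edge a c
      bc : Edge b c
      dv : deg G v ≡ 4
      da : deg G a ≡ 4
      db : deg G b ≡ 4
      dc : deg G c ≡ 4
      dx : deg G x ≡ 3
      dy : deg G y ≡ 3
      v≢c : v ≢ c
      x≢y : x ≢ y

  swap-ab : ∀ {v a b c x y} → StressedAtTriangle v a b c x y → StressedAtTriangle v b a c x y
  swap-ab s = record
    { va = vb ; vb = va ; vx = vx ; vy = vy ; ab = edge-sym ab ; ac = bc ; bc = ac
    ; dv = dv ; da = db ; db = da ; dc = dc ; dx = dx ; dy = dy ; v≢c = v≢c ; x≢y = x≢y }
    where open StressedAtTriangle s

  swap-xy : ∀ {v a b c x y} → StressedAtTriangle v a b c x y → StressedAtTriangle v a b c y x
  swap-xy s = record
    { va = va ; vb = vb ; vx = vy ; vy = vx ; ab = ab ; ac = ac ; bc = bc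
    ; dv = dv ; da = da ; db = db ; dc = dc ; dx = dy ; dy = dx ; v≢c = v≢c ; x≢y = x≢y ∘ sym }
    where open StressedAtTriangle s

  -- ξ is kept abstract: normalising ξ₀ = 1/2⁴⁸ in full, as elaborating `with` or a record with ξ₀ in
  -- a field type does, takes too long. The certificates `_` are solved by η for `T true` once
  -- `certified` has been evaluated, which is much faster than checking `tt` against the type.
  module _ {ξ} (ξ≤ : ξ ℚ.≤ + 1 / 420) {v a b c x y} (s : StressedAtTriangle v a b c x y) where
    open StressedAtTriangle s

    distinct₆ : UniqueVec (v ∷ a ∷ b ∷ c ∷ x ∷ y ∷ [])
    distinct₆ =
      (edge⇒≢ va ∷ edge⇒≢ vb ∷ v≢c ∷ edge⇒≢ vx ∷ edge⇒≢ vy ∷ []) ∷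
      (edge⇒≢ ab ∷ edge⇒≢ ac ∷ degree⇒≢ da dx ∷ degree⇒≢ da dy ∷ []) ∷
      (edge⇒≢ bc ∷ degree⇒≢ db dx ∷ degree⇒≢ db dy ∷ []) ∷
      (degree⇒≢ dc dx ∷ degree⇒≢ dc dy ∷ []) ∷
      (x≢y ∷ []) ∷
      [] ∷ []

    reducible₆ : (P : Pattern 6) → T (certified P degrees₆) →
                 Matches P (triangleOf (Embedding.induced G (v ∷ a ∷ b ∷ c ∷ x ∷ y ∷ []))) → ReducibleConfiguration ξ
    reducible₆ P certificate matches = reducible-at (v ∷ a ∷ b ∷ c ∷ x ∷ y ∷ [])
      (configuration-reducible P degrees₆ certificate G _ distinct₆ (dv ∷ da ∷ db ∷ dc ∷ dx ∷ dy ∷ []) matches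
        (toWitness {a? = 0ℚ ℚ.≤? + 1 / 312} _) (ℚ.≤-trans ξ≤ (toWitness {a? = + 1 / 420 ℚ.≤? + 1 / 312} _)) refl)

    reducible-ax : Edge a x → ReducibleConfiguration ξ
    reducible-ax ax = reducible₆ pattern-ax _
      ((va ∷ vb ∷ _ ∷ vx ∷ vy ∷ []) , (ab ∷ ac ∷ ax ∷ _ ∷ []) , (bc ∷ _ ∷ _ ∷ []) , (_ ∷ _ ∷ []) , (_ ∷ []) , [] , _)

    reducible-cx : Edge c x → ReducibleConfiguration ξ
    reducible-cx cx = reducible₆ pattern-cx _
      ((va ∷ vb ∷ _ ∷ vx ∷ vy ∷ []) , (ab ∷ ac ∷ _ ∷ _ ∷ []) , (bc ∷ _ ∷ _ ∷ []) , (cx ∷ _ ∷ []) , (_ ∷ []) , [] , _)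

    reducible-z : ∀ {z} → Edge a z → deg G z ≡ 3 →
                  ¬ Edge a x → ¬ Edge a y → ¬ Edge b x → ¬ Edge b y → ¬ Edge c x → ¬ Edge c y →
                  ReducibleConfiguration ξ
    reducible-z {z} az dz ¬ax ¬ay ¬bx ¬by ¬cx ¬cy = reducible-at (v ∷ a ∷ b ∷ c ∷ x ∷ y ∷ z ∷ [])
      (configuration-reducible pattern-z degrees₇ _ G _ distinct₇ (dv ∷ da ∷ db ∷ dc ∷ dx ∷ dy ∷ dz ∷ [])
        ( (va ∷ vb ∷ _ ∷ vx ∷ vy ∷ _ ∷ []) , (ab ∷ ac ∷ ¬ax ∷ ¬ay ∷ az ∷ []) , (bc ∷ ¬bx ∷ ¬by ∷ _ ∷ [])
        , (¬cx ∷ ¬cy ∷ _ ∷ []) , (_ ∷ _ ∷ []) , (_ ∷ []) , [] , _)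
        (toWitness {a? = 0ℚ ℚ.≤? + 1 / 420} _) ξ≤ refl)
      where
        distinct₇ : UniqueVec (v ∷ a ∷ b ∷ c ∷ x ∷ y ∷ z ∷ [])
        distinct₇ =
          (edge⇒≢ va ∷ edge⇒≢ vb ∷ v≢c ∷ edge⇒≢ vx ∷ edge⇒≢ vy ∷ degree⇒≢ dv dz ∷ []) ∷
          (edge⇒≢ ab ∷ edge⇒≢ ac ∷ degree⇒≢ da dx ∷ degree⇒≢ da dy ∷ edge⇒≢ az ∷ []) ∷
          (edge⇒≢ bc ∷ degree⇒≢ db dx ∷ degree⇒≢ db dy ∷ degree⇒≢ db dz ∷ []) ∷
          (degree⇒≢ dc dx ∷ degree⇒≢ dc dy ∷ degree⇒≢ dc dz ∷ []) ∷
          (x≢y ∷ (λ { refl → ¬ax az }) ∷ []) ∷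
          ((λ { refl → ¬ay az }) ∷ []) ∷
          [] ∷ []

  reducible-configuration : ∀ {ξ} → ξ ℚ.≤ + 1 / 420 → ∀ {v a b c x y} → StressedAtTriangle v a b c x y →
                            Conductive G a → ReducibleConfiguration ξ
  reducible-configuration ξ≤ {v} {a} {b} {c} {x} {y} s (_ , one)
    with T? (adj G a x) | T? (adj G a y) | T? (adj G b x) | T? (adj G b y) | T? (adj G c x) | T? (adj G c y)
  ... | yes ax | _      | _      | _      | _      | _      = reducible-ax ξ≤ s ax
  ... | no _   | yes ay | _      | _      | _      | _      = reducible-ax ξ≤ (swap-xy s) ay
  ... | no _   | no _   | yes bx | _      | _      | _      = reducible-ax ξ≤ (swap-ab s) bx
  ... | no _   | no _   | no _   | yes by | _      | _      = reducible-ax ξ≤ (swap-ab (swap-xy s)) by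
  ... | no _   | no _   | no _   | no _   | yes cx | _      = reducible-cx ξ≤ s cx
  ... | no _   | no _   | no _   | no _   | no _   | yes cy = reducible-cx ξ≤ (swap-xy s) cy
  ... | no ¬ax | no ¬ay | no ¬bx | no ¬by | no ¬cx | no ¬cy =
    let z , az , dz = one-degree3-neighbour a one in reducible-z ξ≤ s {z} az dz ¬ax ¬ay ¬bx ¬by ¬cx ¬cy

lemma4p7 : ∀ {n : ℕ} (G : Graph n) →
    (∀ (S : VSet n) → NonEmpty S → ¬ Reducible G S ξ₀) →
    ∀ (v a b c : Fin n) → Stressed G v → ConductiveTriangle G a b c →
    T (adj G v a) → T (adj G v b) → ⊥
lemma4p7 G irreducible v a b c stressed (ab , bc , ac , a-conductive , (db , _) , c-conductive) va vb =
  let dv , two = stressed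
      da , _   = a-conductive
      dc , _   = c-conductive
      x , y , x≢y , (vx , dx) , (vy , dy) = two-degree3-neighbours G v two
      situation = record
        { va = va ; vb = vb ; vx = vx ; vy = vy ; ab = ab ; ac = ac ; bc = bc
        ; dv = dv ; da = da ; db = db ; dc = dc ; dx = dx ; dy = dy
        ; v≢c = stressed≢conductive G stressed c-conductive ; x≢y = x≢y }
  in no-reducible-configuration G irreducible
       (reducible-configuration G (toWitness {a? = ξ₀ ℚ.≤? + 1 / 420} _) situation a-conductive)
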